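{- Let $\mathbf U=\langle\langle U,\approx\rangle,\preceq\rangle$ be a completely lattice $\mathbf L$-ordered set and $\sim$ a complete $\mathbf L$-tolerance on $\mathbf U$. For all $u,v\in U$, $u\sim v=(u_\sim\preceq v)\wedge(v\preceq u^\sim)$.
   Context: $\mathbf L=\langle L,\wedge,\vee,\otimes,\to,0,1\rangle$ is a complete residuated lattice ($\langle L,\wedge,\vee,0,1\rangle$ complete lattice, $\langle L,\otimes,1\rangle$ commutative monoid, $a\otimes b\le c$ iff $a\le b\to c$). An $\mathbf L$-set in $X$ is a map $X\to L$; $L^X$ the set of them; $S(A,B)=\bigwedge_x(A(x)\to B(x))$. An $\mathbf L$-equality is a binary $\mathbf L$-relation that is reflexive, symmetric, transitive ($R(x,y)\otimes R(y,z)\le R(x,z)$) and with $R(x,y)=1\Rightarrow x=y$. An $\mathbf L$-ordered set is $\langle\langle U,\approx\rangle,\preceq\rangle$, $\approx$ an $\mathbf L$-equality, $\preceq$ reflexive, transitive, compatible with $\approx$ ($(u\preceq v)\otimes(u\approx u')\otimes(v\approx v')\le(u'\preceq v')$), and $(u\preceq v)\wedge(v\preceq u)\le u\approx v$. For $V\in L^U$: $\mathcal L V(v)=\bigwedge_u(V(u)\to(v\preceq u))$, $\mathcal U V(v)=\bigwedge_u(V(u)\to(u\preceq v))$; $\inf V$ is the unique $u$ with $\mathcal L V(u)=1=\mathcal U(\mathcal L V)(u)$, $\sup V$ the unique $u$ with $\mathcal U V(u)=1=\mathcal L(\mathcal U V)(u)$; completely lattice means these exist for all $V$. Power relation: for $R$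 on $X$, $A,B\in L^X$, $(R\circ B)(x)=\bigvee_y R(x,y)\otimes B(y)$, $(A\circ R)(y)=\bigvee_x A(x)\otimes R(x,y)$, $R^+(A,B)=S(A,R\circ B)\wedge S(B,A\circ R)$. A binary $\mathbf L$-relation $R$ on $\mathbf U$ is complete if it is compatible with $\approx$ ($R(u,v)\otimes(u\approx u')\otimes(v\approx v')\le R(u',v')$) and $R^+(V_1,V_2)\le R(\inf V_1,\inf V_2)$, $R^+(V_1,V_2)\le R(\sup V_1,\sup V_2)$ for all $V_1,V_2\in L^U$. An $\mathbf L$-tolerance is a reflexive symmetric binary $\mathbf L$-relation. For $u\in U$, $[u]_\sim(v)=u\sim v$, $u_\sim=\inf[u]_\sim$, $u^\sim=\sup[u]_\sim$. -}

module Defs where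

open import Level using (Level; suc)
open import Data.Product using (Σ; _×_; _,_; proj₁; proj₂)
open import Relation.Binary.PropositionalEquality using (_≡_)

record CompleteResiduatedLattice (ℓ : Level) : Set (suc ℓ) where
  infixr 7 _⊗_
  infixr 6 _∧_
  infixr 5 _∨_
  infixr 4 _⇒_
  infix 3 _≤_
  field
    Carrier : Set ℓ
    _≤_ : Carrier → Carrier → Set ℓ
    ≤-refl : ∀ {a} → a ≤ a
    ≤-trans : ∀ {a b c} → a ≤ b → b ≤ c → a ≤ c
    ≤-antisym : ∀ {a b} → a ≤ b → b ≤ a → a ≡ b
    ⋀ : {I : Set ℓ} → (I → Carrier) → Carrier
    ⋀-lower : ∀ {I : Set ℓ} (f : I → Carrier) (i : I) → ⋀ f ≤ f i
    ⋀-greatest : ∀ {I : Set ℓ} (f : I → Carrier) (a : Carrier) → (∀ i → a ≤ f i) → a ≤ ⋀ f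
    ⋁ : {I : Set ℓ} → (I → Carrier) → Carrier
    ⋁-upper : ∀ {I : Set ℓ} (f : I → Carrier) (i : I) → f i ≤ ⋁ f
    ⋁-least : ∀ {I : Set ℓ} (f : I → Carrier) (a : Carrier) → (∀ i → f i ≤ a) → ⋁ f ≤ a
    _∧_ : Carrier → Carrier → Carrier
    ∧-lower₁ : ∀ a b → a ∧ b ≤ a
    ∧-lower₂ : ∀ a b → a ∧ b ≤ b
    ∧-greatest : ∀ a b c → c ≤ a → c ≤ b → c ≤ a ∧ b
    _∨_ : Carrier → Carrier → Carrier
    ∨-upper₁ : ∀ a b → a ≤ a ∨ b
    ∨-upper₂ : ∀ a b → b ≤ a ∨ b
    ∨-least : ∀ a b c → a ≤ c → b ≤ c → a ∨ b ≤ c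
    0ₗ : Carrier
    0-least : ∀ a → 0ₗ ≤ a
    1ₗ : Carrier
    1-greatest : ∀ a → a ≤ 1ₗ
    _⊗_ : Carrier → Carrier → Carrier
    ⊗-assoc : ∀ a b c → (a ⊗ b) ⊗ c ≡ a ⊗ (b ⊗ c)
    ⊗-comm : ∀ a b → a ⊗ b ≡ b ⊗ a
    ⊗-identityˡ : ∀ a → 1ₗ ⊗ a ≡ a
    _⇒_ : Carrier → Carrier → Carrier
    adjoint₁ : ∀ {a b c} → a ⊗ b ≤ c → a ≤ b ⇒ c
    adjoint₂ : ∀ {a b c} → a ≤ b ⇒ c → a ⊗ b ≤ c

module _ {ℓ : Level} (𝐋 : CompleteResiduatedLattice ℓ) where
  open CompleteResiduatedLattice 𝐋

  LSet : Set ℓ → Set ℓ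
  LSet X = X → Carrier

  LRel : Set ℓ → Set ℓ
  LRel X = X → X → Carrier

  S : {X : Set ℓ} → LSet X → LSet X → Carrier
  S A B = ⋀ (λ x → A x ⇒ B x)

  _∘ʳ_ : {X : Set ℓ} → LRel X → LSet X → LSet X
  (R ∘ʳ B) x = ⋁ (λ y → R x y ⊗ B y)

  _ʳ∘_ : {X : Set ℓ} → LSet X → LRel X → LSet X
  (A ʳ∘ R) y = ⋁ (λ x → A x ⊗ R x y)

  PowerRel : {X : Set ℓ} → LRel X → LSet X → LSet X → Carrier
  PowerRel R A B = S A (R ∘ʳ B) ∧ S B (A ʳ∘ R)

  record IsLEquality {X : Set ℓ} (E : LRel X) : Set ℓ where
    field
      refl : ∀ x → E x x ≡ 1ₗ
      sym : ∀ x y → E x y ≡ E y x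
      trans : ∀ x y z → E x y ⊗ E y z ≤ E x z
      separated : ∀ x y → E x y ≡ 1ₗ → x ≡ y

  record LOrderedSet : Set (Level.suc ℓ) where
    field
      U : Set ℓ
      _≈_ : LRel U
      _≼_ : LRel U
      ≈-isLEquality : IsLEquality _≈_
      ≼-refl : ∀ u → u ≼ u ≡ 1ₗ
      ≼-trans : ∀ u v w → (u ≼ v) ⊗ (v ≼ w) ≤ u ≼ w
      ≼-compat : ∀ u v u' v' → (u ≼ v) ⊗ (u ≈ u') ⊗ (v ≈ v') ≤ u' ≼ v'
      ≼-antisym : ∀ u v → (u ≼ v) ∧ (v ≼ u) ≤ u ≈ v

  module _ (𝐔 : LOrderedSet) where
    open LOrderedSet 𝐔

    𝓛 : LSet U → LSet U
    𝓛 V v = ⋀ (λ u → V u ⇒ (v ≼ u))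

    𝓤 : LSet U → LSet U
    𝓤 V v = ⋀ (λ u → V u ⇒ (u ≼ v))

    IsInf : LSet U → U → Set ℓ
    IsInf V u = (𝓛 V u ≡ 1ₗ) × (𝓤 (𝓛 V) u ≡ 1ₗ)

    IsSup : LSet U → U → Set ℓ
    IsSup V u = (𝓤 V u ≡ 1ₗ) × (𝓛 (𝓤 V) u ≡ 1ₗ)

    -- completely lattice: infimum and supremum exist for every V
    -- (they are then unique, so they may be chosen as functions)
    CompletelyLattice : Set ℓ
    CompletelyLattice = ((V : LSet U) → Σ U (IsInf V)) × ((V : LSet U) → Σ U (IsSup V))

    module _ (cl : CompletelyLattice) where
      inf : LSet U → U
      inf V = proj₁ (proj₁ cl V)

      sup : LSet U → U
      sup V = proj₁ (proj₂ cl V)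

      record IsComplete (R : LRel U) : Set ℓ where
        field
          compat : ∀ u v u' v' → R u v ⊗ (u ≈ u') ⊗ (v ≈ v') ≤ R u' v'
          inf-pres : ∀ (V₁ V₂ : LSet U) → PowerRel R V₁ V₂ ≤ R (inf V₁) (inf V₂)
          sup-pres : ∀ (V₁ V₂ : LSet U) → PowerRel R V₁ V₂ ≤ R (sup V₁) (sup V₂)

      -- [u]_∼, u_∼ = inf [u]_∼, u^∼ = sup [u]_∼
      class : LRel U → U → LSet U
      class R u v = R u v

      lowerEnd : LRel U → U → U
      lowerEnd R u = inf (class R u)

      upperEnd : LRel U → U → U
      upperEnd R u = sup (class R u)

  record IsLTolerance {X : Set ℓ} (R : LRel X) : Set ℓ where
    field
      refl : ∀ x → R x x ≡ 1ₗ
      sym : ∀ x y → R x y ≡ R y x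

-- As u_∼ and u^∼ are the infimum and supremum of [u]_∼, the degree u ∼ v bounds both u_∼ ≼ v
-- and v ≼ u^∼. For the converse only reflexivity of ∼ is needed,
-- together with completeness applied three times:
--   * to {u} and [u]_∼ (power degree 1): u ∼ u_∼ = u ∼ u^∼ = 1;
--   * with y = v ≼ u^∼, to {v, y/u} and {v, y/u^∼}, whose infima are some m and v:
--     m ∼ v = 1 and y ≤ m ≼ u;
--   * with x = u_∼ ≼ v, to {u, y/m} and {v, x/u_∼}, whose suprema are u and v:
--     x ∧ y ≤ u ∼ v.
module Submission where

open import Level using (Level)
open import Data.Product using (proj₁; proj₂)
open import Relation.Binary.Bundles using (Poset)
open import Relation.Binary.PropositionalEquality
  using (_≡_; refl; sym; trans; subst; subst₂; isEquivalence)
import Relation.Binary.Reasoning.PartialOrder as PosetReasoning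
open import Defs
  using (CompleteResiduatedLattice; LOrderedSet; CompletelyLattice; IsComplete;
         IsLEquality; IsLTolerance; LSet; LRel; lowerEnd; upperEnd)
import Defs as D

module ResiduatedLatticeProperties {ℓ : Level} (𝐋 : CompleteResiduatedLattice ℓ) where
  open CompleteResiduatedLattice 𝐋

  ≤-poset : Poset ℓ ℓ ℓ
  ≤-poset = record
    { isPartialOrder = record
      { isPreorder = record
        { isEquivalence = isEquivalence
        ; reflexive = λ { refl → ≤-refl }
        ; trans = ≤-trans
        }
      ; antisym = ≤-antisym
      }
    }

  open PosetReasoning ≤-poset

  ≤-reflexive : ∀ {a b} → a ≡ b → a ≤ b
  ≤-reflexive refl = ≤-refl

  ⊗-identityʳ : ∀ a → a ⊗ 1ₗ ≡ a
  ⊗-identityʳ a = trans (⊗-comm a 1ₗ) (⊗-identityˡ a)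

  ⊗-monoˡ-≤ : ∀ c {a b} → a ≤ b → a ⊗ c ≤ b ⊗ c
  ⊗-monoˡ-≤ c a≤b = adjoint₂ (≤-trans a≤b (adjoint₁ ≤-refl))

  ⊗-monoʳ-≤ : ∀ c {a b} → a ≤ b → c ⊗ a ≤ c ⊗ b
  ⊗-monoʳ-≤ c {a} {b} a≤b = begin
    c ⊗ a  ≡⟨ ⊗-comm c a ⟩
    a ⊗ c  ≤⟨ ⊗-monoˡ-≤ c a≤b ⟩
    b ⊗ c  ≡⟨ ⊗-comm b c ⟩
    c ⊗ b  ∎

  ⊗-mono-≤ : ∀ {a b c d} → a ≤ b → c ≤ d → a ⊗ c ≤ b ⊗ d
  ⊗-mono-≤ {b = b} {c} a≤b c≤d = ≤-trans (⊗-monoˡ-≤ c a≤b) (⊗-monoʳ-≤ b c≤d)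

  1≤⇒≤⊗ˡ : ∀ {a} b → 1ₗ ≤ a → b ≤ a ⊗ b
  1≤⇒≤⊗ˡ b 1≤a = ≤-trans (≤-reflexive (sym (⊗-identityˡ b))) (⊗-monoˡ-≤ b 1≤a)

  1≤⇒≤⊗ʳ : ∀ {a} b → 1ₗ ≤ a → b ≤ b ⊗ a
  1≤⇒≤⊗ʳ b 1≤a = ≤-trans (≤-reflexive (sym (⊗-identityʳ b))) (⊗-monoʳ-≤ b 1≤a)

  ⊗-∨-least : ∀ {a b c d} → a ⊗ b ≤ d → a ⊗ c ≤ d → a ⊗ (b ∨ c) ≤ d
  ⊗-∨-least {a} {b} {c} {d} ab≤d ac≤d = begin
    a ⊗ (b ∨ c)  ≡⟨ ⊗-comm a (b ∨ c) ⟩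
    (b ∨ c) ⊗ a  ≤⟨ adjoint₂ (∨-least b c (a ⇒ d) (residual ab≤d) (residual ac≤d)) ⟩
    d            ∎
    where
    residual : ∀ {x} → a ⊗ x ≤ d → x ≤ a ⇒ d
    residual {x} ax≤d = adjoint₁ (≤-trans (≤-reflexive (⊗-comm x a)) ax≤d)

  S : {X : Set ℓ} → LSet 𝐋 X → LSet 𝐋 X → Carrier
  S = D.S 𝐋

  R⁺ : {X : Set ℓ} → LRel 𝐋 X → LSet 𝐋 X → LSet 𝐋 X → Carrier
  R⁺ = D.PowerRel 𝐋

  infixr 6 _∪_
  infixr 7 _·_

  _∪_ : {X : Set ℓ} → LSet 𝐋 X → LSet 𝐋 X → LSet 𝐋 X
  (A ∪ B) x = A x ∨ B x

  _·_ : {X : Set ℓ} → Carrier → LSet 𝐋 X → LSet 𝐋 X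
  (c · A) x = c ⊗ A x

  module _ {X : Set ℓ} where

    S-intro : ∀ {A B : LSet 𝐋 X} {e} → (∀ x → e ⊗ A x ≤ B x) → e ≤ S A B
    S-intro {e = e} h = ⋀-greatest _ e (λ x → adjoint₁ (h x))

    S-elim : ∀ {A B : LSet 𝐋 X} {e} → e ≤ S A B → ∀ x → e ⊗ A x ≤ B x
    S-elim e≤S x = adjoint₂ (≤-trans e≤S (⋀-lower _ x))

    S≡1⇒⊆ : ∀ {A B : LSet 𝐋 X} → S A B ≡ 1ₗ → ∀ x → A x ≤ B x
    S≡1⇒⊆ {A} S≡1 x =
      ≤-trans (1≤⇒≤⊗ˡ (A x) ≤-refl) (S-elim (≤-reflexive (sym S≡1)) x)

    ⊆⇒1≤S : ∀ {A B : LSet 𝐋 X} → (∀ x → A x ≤ B x) → 1ₗ ≤ S A B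
    ⊆⇒1≤S {A} A⊆B = S-intro (λ x → ≤-trans (≤-reflexive (⊗-identityˡ (A x))) (A⊆B x))

    S-∪ : ∀ {A B C : LSet 𝐋 X} {e} → e ≤ S A C → e ≤ S B C → e ≤ S (A ∪ B) C
    S-∪ e≤SAC e≤SBC = S-intro (λ x → ⊗-∨-least (S-elim e≤SAC x) (S-elim e≤SBC x))

    S-· : ∀ {A B : LSet 𝐋 X} {c e} → e ⊗ c ≤ S A B → e ≤ S (c · A) B
    S-· {A} {B} {c} {e} ec≤S = S-intro λ x → begin
      e ⊗ c ⊗ A x    ≡⟨ sym (⊗-assoc e c (A x)) ⟩
      (e ⊗ c) ⊗ A x  ≤⟨ S-elim ec≤S x ⟩
      B x            ∎

module LOrderedSetProperties {ℓ : Level} {𝐋 : CompleteResiduatedLattice ℓ}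
                             (𝐔 : LOrderedSet 𝐋) where
  open CompleteResiduatedLattice 𝐋
  open ResiduatedLatticeProperties 𝐋
  open PosetReasoning ≤-poset
  open LOrderedSet 𝐔
  private module ≈ = IsLEquality ≈-isLEquality

  -- Points are taken ≈-closed, so ⦅ p ⦆ ∪ c · ⦅ q ⦆ plays the role of the two-point set {p, c/q}.
  ⦅_⦆ : U → LSet 𝐋 U
  ⦅ p ⦆ = p ≈_

  ⦅⦆-∋ : ∀ p → 1ₗ ≤ ⦅ p ⦆ p
  ⦅⦆-∋ p = ≤-reflexive (sym (≈.refl p))

  ⦅⦆∪·-∋ˡ : ∀ c p q → 1ₗ ≤ (⦅ p ⦆ ∪ c · ⦅ q ⦆) p
  ⦅⦆∪·-∋ˡ c p q = ≤-trans (⦅⦆-∋ p) (∨-upper₁ _ _)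

  ⦅⦆∪·-∋ʳ : ∀ c p q → c ≤ (⦅ p ⦆ ∪ c · ⦅ q ⦆) q
  ⦅⦆∪·-∋ʳ c p q = ≤-trans (1≤⇒≤⊗ʳ c (⦅⦆-∋ q)) (∨-upper₂ _ _)

  ≼-refl₁ : ∀ p → 1ₗ ≤ p ≼ p
  ≼-refl₁ p = ≤-reflexive (sym (≼-refl p))

  ≼-antisym₁ : ∀ {p q} → 1ₗ ≤ p ≼ q → 1ₗ ≤ q ≼ p → p ≡ q
  ≼-antisym₁ {p} {q} 1≤p≼q 1≤q≼p = ≈.separated p q
    (≤-antisym (1-greatest _) (≤-trans (∧-greatest _ _ _ 1≤p≼q 1≤q≼p) (≼-antisym p q)))

  ≈⇒≼ : ∀ p q → p ≈ q ≤ p ≼ q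
  ≈⇒≼ p q = begin
    p ≈ q                          ≤⟨ 1≤⇒≤⊗ˡ _ (⦅⦆-∋ p) ⟩
    (p ≈ p) ⊗ (p ≈ q)              ≤⟨ 1≤⇒≤⊗ˡ _ (≼-refl₁ p) ⟩
    (p ≼ p) ⊗ (p ≈ p) ⊗ (p ≈ q)    ≤⟨ ≼-compat p p p q ⟩
    p ≼ q                          ∎

  ≈⇒≽ : ∀ p q → p ≈ q ≤ q ≼ p
  ≈⇒≽ p q = ≤-trans (≤-reflexive (≈.sym p q)) (≈⇒≼ q p)

  ≼-respʳ-≈ : ∀ p q z → (p ≼ q) ⊗ (q ≈ z) ≤ p ≼ z
  ≼-respʳ-≈ p q z =
    ≤-trans (⊗-monoʳ-≤ (p ≼ q) (1≤⇒≤⊗ˡ _ (⦅⦆-∋ p))) (≼-compat p q p z)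

  ≼-respˡ-≈ : ∀ p q z → (q ≼ p) ⊗ (q ≈ z) ≤ z ≼ p
  ≼-respˡ-≈ p q z =
    ≤-trans (⊗-monoʳ-≤ (q ≼ p) (1≤⇒≤⊗ʳ _ (⦅⦆-∋ p))) (≼-compat q p z p)

  module _ {R : LRel 𝐋 U}
           (R-compat : ∀ u v u' v' → R u v ⊗ (u ≈ u') ⊗ (v ≈ v') ≤ R u' v') where

    R-respˡ-≈ : ∀ {p q} w → 1ₗ ≤ R p q → p ≈ w ≤ R w q
    R-respˡ-≈ {p} {q} w 1≤Rpq = begin
      p ≈ w                        ≤⟨ 1≤⇒≤⊗ʳ _ (⦅⦆-∋ q) ⟩
      (p ≈ w) ⊗ (q ≈ q)            ≤⟨ 1≤⇒≤⊗ˡ _ 1≤Rpq ⟩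
      R p q ⊗ (p ≈ w) ⊗ (q ≈ q)    ≤⟨ R-compat p q w q ⟩
      R w q                        ∎

    R-respʳ-≈ : ∀ {p q} w → 1ₗ ≤ R p q → q ≈ w ≤ R p w
    R-respʳ-≈ {p} {q} w 1≤Rpq = begin
      q ≈ w                        ≤⟨ 1≤⇒≤⊗ˡ _ (⦅⦆-∋ p) ⟩
      (p ≈ p) ⊗ (q ≈ w)            ≤⟨ 1≤⇒≤⊗ˡ _ 1≤Rpq ⟩
      R p q ⊗ (p ≈ p) ⊗ (q ≈ w)    ≤⟨ R-compat p q p w ⟩
      R p w                        ∎

    S-⦅⦆-∘ʳ : ∀ {p q} {B : LSet 𝐋 U} {e} →
              1ₗ ≤ R p q → e ≤ B q → e ≤ S ⦅ p ⦆ (D._∘ʳ_ 𝐋 R B)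
    S-⦅⦆-∘ʳ {p} {q} {B} {e} 1≤Rpq e≤Bq = S-intro λ w → begin
      e ⊗ (p ≈ w)    ≤⟨ ⊗-mono-≤ e≤Bq (R-respˡ-≈ w 1≤Rpq) ⟩
      B q ⊗ R w q    ≡⟨ ⊗-comm (B q) (R w q) ⟩
      R w q ⊗ B q    ≤⟨ ⋁-upper _ q ⟩
      D._∘ʳ_ 𝐋 R B w ∎

    S-⦅⦆-ʳ∘ : ∀ {p q} {A : LSet 𝐋 U} {e} →
              1ₗ ≤ R p q → e ≤ A p → e ≤ S ⦅ q ⦆ (D._ʳ∘_ 𝐋 A R)
    S-⦅⦆-ʳ∘ {p} {q} {A} {e} 1≤Rpq e≤Ap = S-intro λ w → begin
      e ⊗ (q ≈ w)    ≤⟨ ⊗-mono-≤ e≤Ap (R-respʳ-≈ w 1≤Rpq) ⟩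
      A p ⊗ R p w    ≤⟨ ⋁-upper _ p ⟩
      D._ʳ∘_ 𝐋 A R w ∎

    R⁺-⦅⦆-class : (∀ x → R x x ≡ 1ₗ) → ∀ p → 1ₗ ≤ R⁺ R ⦅ p ⦆ (R p)
    R⁺-⦅⦆-class R-refl p = ∧-greatest _ _ _
      (S-⦅⦆-∘ʳ (≤-reflexive (sym (R-refl p))) (≤-reflexive (sym (R-refl p))))
      (S-intro λ w → ≤-trans (⊗-monoˡ-≤ (R p w) (⦅⦆-∋ p)) (⋁-upper _ p))

    R⁺-⦅⦆∪·-parallel : ∀ {p q p' q'} c → 1ₗ ≤ R p p' → 1ₗ ≤ R q q' →
                       1ₗ ≤ R⁺ R (⦅ p ⦆ ∪ c · ⦅ q ⦆) (⦅ p' ⦆ ∪ c · ⦅ q' ⦆)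
    R⁺-⦅⦆∪·-parallel {p} {q} {p'} {q'} c 1≤Rpp' 1≤Rqq' = ∧-greatest _ _ _
      (S-∪ (S-⦅⦆-∘ʳ 1≤Rpp' (⦅⦆∪·-∋ˡ c p' q'))
           (S-· (S-⦅⦆-∘ʳ 1≤Rqq' (1⊗c≤ (⦅⦆∪·-∋ʳ c p' q')))))
      (S-∪ (S-⦅⦆-ʳ∘ 1≤Rpp' (⦅⦆∪·-∋ˡ c p q))
           (S-· (S-⦅⦆-ʳ∘ 1≤Rqq' (1⊗c≤ (⦅⦆∪·-∋ʳ c p q)))))
      where
      1⊗c≤ : ∀ {a} → c ≤ a → 1ₗ ⊗ c ≤ a
      1⊗c≤ = ≤-trans (≤-reflexive (⊗-identityˡ c))

    R⁺-⦅⦆∪·-crossed : ∀ {p q p' q' c d e} → 1ₗ ≤ R p q' → 1ₗ ≤ R q p' → e ≤ c → e ≤ d →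
                      e ≤ R⁺ R (⦅ p ⦆ ∪ c · ⦅ q ⦆) (⦅ p' ⦆ ∪ d · ⦅ q' ⦆)
    R⁺-⦅⦆∪·-crossed {p} {q} {p'} {q'} {c} {d} 1≤Rpq' 1≤Rqp' e≤c e≤d = ∧-greatest _ _ _
      (S-∪ (S-⦅⦆-∘ʳ 1≤Rpq' (≤-trans e≤d (⦅⦆∪·-∋ʳ d p' q')))
           (S-· (S-⦅⦆-∘ʳ 1≤Rqp' (≤-trans (1-greatest _) (⦅⦆∪·-∋ˡ d p' q')))))
      (S-∪ (S-⦅⦆-ʳ∘ 1≤Rqp' (≤-trans e≤c (⦅⦆∪·-∋ʳ c p q)))
           (S-· (S-⦅⦆-ʳ∘ 1≤Rpq' (≤-trans (1-greatest _) (⦅⦆∪·-∋ˡ c p q)))))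

  module _ (cl : CompletelyLattice 𝐋 𝐔) where

    inf sup : LSet 𝐋 U → U
    inf = D.inf 𝐋 𝐔 cl
    sup = D.sup 𝐋 𝐔 cl

    inf-lowerBound : ∀ V z → V z ≤ inf V ≼ z
    inf-lowerBound V = S≡1⇒⊆ (proj₁ (proj₂ (proj₁ cl V)))

    sup-upperBound : ∀ V z → V z ≤ z ≼ sup V
    sup-upperBound V = S≡1⇒⊆ (proj₁ (proj₂ (proj₂ cl V)))

    inf-≡-minimum : ∀ V p → 1ₗ ≤ V p → (∀ z → V z ≤ p ≼ z) → inf V ≡ p
    inf-≡-minimum V p 1≤Vp p-lower = ≼-antisym₁
      (≤-trans 1≤Vp (inf-lowerBound V p))
      (≤-trans (⊆⇒1≤S p-lower) (S≡1⇒⊆ (proj₂ (proj₂ (proj₁ cl V))) p))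

    sup-≡-maximum : ∀ V p → 1ₗ ≤ V p → (∀ z → V z ≤ z ≼ p) → sup V ≡ p
    sup-≡-maximum V p 1≤Vp p-upper = ≼-antisym₁
      (≤-trans (⊆⇒1≤S p-upper) (S≡1⇒⊆ (proj₂ (proj₂ (proj₂ cl V))) p))
      (≤-trans 1≤Vp (sup-upperBound V p))

    inf-⦅⦆ : ∀ p → inf ⦅ p ⦆ ≡ p
    inf-⦅⦆ p = inf-≡-minimum ⦅ p ⦆ p (⦅⦆-∋ p) (≈⇒≼ p)

    sup-⦅⦆ : ∀ p → sup ⦅ p ⦆ ≡ p
    sup-⦅⦆ p = sup-≡-maximum ⦅ p ⦆ p (⦅⦆-∋ p) (≈⇒≽ p)

    inf-⦅⦆∪· : ∀ {c p q} → c ≤ p ≼ q → inf (⦅ p ⦆ ∪ c · ⦅ q ⦆) ≡ p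
    inf-⦅⦆∪· {c} {p} {q} c≤p≼q = inf-≡-minimum _ p (⦅⦆∪·-∋ˡ c p q) λ z →
      ∨-least _ _ _ (≈⇒≼ p z) (≤-trans (⊗-monoˡ-≤ (q ≈ z) c≤p≼q) (≼-respʳ-≈ p q z))

    sup-⦅⦆∪· : ∀ {c p q} → c ≤ q ≼ p → sup (⦅ p ⦆ ∪ c · ⦅ q ⦆) ≡ p
    sup-⦅⦆∪· {c} {p} {q} c≤q≼p = sup-≡-maximum _ p (⦅⦆∪·-∋ˡ c p q) λ z →
      ∨-least _ _ _ (≈⇒≽ p z) (≤-trans (⊗-monoˡ-≤ (q ≈ z) c≤q≼p) (≼-respˡ-≈ p q z))

    module _ {R : LRel 𝐋 U} (R-refl : ∀ x → R x x ≡ 1ₗ)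
             (R-complete : IsComplete 𝐋 𝐔 cl R) where
      open IsComplete R-complete

      lower upper : U → U
      lower = lowerEnd 𝐋 𝐔 cl R
      upper = upperEnd 𝐋 𝐔 cl R

      R-lower : ∀ u → 1ₗ ≤ R u (lower u)
      R-lower u = subst (λ t → 1ₗ ≤ R t (lower u)) (inf-⦅⦆ u)
        (≤-trans (R⁺-⦅⦆-class compat R-refl u) (inf-pres ⦅ u ⦆ (R u)))

      R-upper : ∀ u → 1ₗ ≤ R u (upper u)
      R-upper u = subst (λ t → 1ₗ ≤ R t (upper u)) (sup-⦅⦆ u)
        (≤-trans (R⁺-⦅⦆-class compat R-refl u) (sup-pres ⦅ u ⦆ (R u)))

      R-≤-ends : ∀ u v → R u v ≤ (lower u ≼ v) ∧ (v ≼ upper u)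
      R-≤-ends u v = ∧-greatest _ _ _ (inf-lowerBound (R u) v) (sup-upperBound (R u) v)

      ends-≤-R : ∀ u v → (lower u ≼ v) ∧ (v ≼ upper u) ≤ R u v
      ends-≤-R u v = subst₂ (λ s t → x ∧ y ≤ R s t) (sup-⦅⦆∪· y≤m≼u) (sup-⦅⦆∪· ≤-refl)
        (≤-trans (R⁺-⦅⦆∪·-crossed compat (R-lower u) 1≤Rmv (∧-lower₂ x y) (∧-lower₁ x y))
                 (sup-pres (⦅ u ⦆ ∪ y · ⦅ m ⦆) (⦅ v ⦆ ∪ x · ⦅ lower u ⦆)))
        where
        x = lower u ≼ v
        y = v ≼ upper u
        m = inf (⦅ v ⦆ ∪ y · ⦅ u ⦆)

        1≤Rmv : 1ₗ ≤ R m v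
        1≤Rmv = subst (λ t → 1ₗ ≤ R m t) (inf-⦅⦆∪· ≤-refl)
          (≤-trans (R⁺-⦅⦆∪·-parallel compat y (≤-reflexive (sym (R-refl v))) (R-upper u))
                   (inf-pres (⦅ v ⦆ ∪ y · ⦅ u ⦆) (⦅ v ⦆ ∪ y · ⦅ upper u ⦆)))

        y≤m≼u : y ≤ m ≼ u
        y≤m≼u = ≤-trans (⦅⦆∪·-∋ʳ y v u) (inf-lowerBound _ u)

lemma24 : {ℓ : Level} (𝐋 : CompleteResiduatedLattice ℓ) (𝐔 : LOrderedSet 𝐋)
          (cl : CompletelyLattice 𝐋 𝐔) (_∼_ : LRel 𝐋 (LOrderedSet.U 𝐔)) →
          IsLTolerance 𝐋 _∼_ → IsComplete 𝐋 𝐔 cl _∼_ →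
          ∀ u v → (u ∼ v) ≡ CompleteResiduatedLattice._∧_ 𝐋
            (LOrderedSet._≼_ 𝐔 (lowerEnd 𝐋 𝐔 cl _∼_ u) v)
            (LOrderedSet._≼_ 𝐔 v (upperEnd 𝐋 𝐔 cl _∼_ u))
lemma24 𝐋 𝐔 cl _∼_ tolerance complete u v =
  ≤-antisym (R-≤-ends cl (IsLTolerance.refl tolerance) complete u v)
            (ends-≤-R cl (IsLTolerance.refl tolerance) complete u v)
  where
  open CompleteResiduatedLattice 𝐋 using (≤-antisym)
  open LOrderedSetProperties 𝐔
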